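{- Let $I$ be a non-empty set and let $\mathbb{X}_i=\langle X_i,\rho_i\rangle$, $i\in I$, be pairwise disjoint, connected and reversible binary structures such that the sequence $\langle\mathbb{X}_i : i\in I\rangle$ is rich for monomorphisms. Then: (a) for all $i,j\in I$, if $|X_i|=|X_j|$ then $\mathbb{X}_i\cong\mathbb{X}_j$; (b) the disjoint union $\bigcup_{i\in I}\mathbb{X}_i=\langle\bigcup_{i\in I}X_i,\bigcup_{i\in I}\rho_i\rangle$ is reversible if and only if $\langle |X_i| : i\in I\rangle$ is a reversible sequence of cardinals.
   Context: A binary structure is a pair $\langle X,\rho\rangle$ with $X\neq\emptyset$ and $\rho\subseteq X^2$. A homomorphism $g:\langle X,\rho\rangle\to\langle Y,\sigma\rangle$ is a map with $\langle x,y\rangle\in\rho\Rightarrow\langle g(x),g(y)\rangle\in\sigma$; a monomorphism is an injective homomorphism, a condensation is a bijective homomorphism. A structure is reversible iff every condensation from it onto itself is an automorphism. $\langle X,\rho\rangle$ is connected iff the transitive closure of $\Delta_X\cup\rho\cup\rho^{ -1}$ is $X^2$. A sequence of structures $\langle\mathbb{X}_i : i\in I\rangle$ is rich for monomorphisms iff for all $i,j\in I$ and every $A\subseteq X_j$ with $|A|=|X_i|$ there is a monomorphism $g:\mathbb{X}_i\to\mathbb{X}_j$ with $g[X_i]=A$. A sequence of non-zero cardinals $\langle\kappa_i:i\in I\rangle$ is reversible iff there is no non-injective surjection $f:I\to I$ such that $\kappa_j=\sum_{i\in f^{ -1}[\{j\}]}\kappa_i$ for all $j\in I$. -}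

module Defs where

open import Data.Product using (Σ; ∃; _×_; _,_; proj₁)
open import Relation.Nullary using (¬_)
open import Relation.Binary.PropositionalEquality using (_≡_)
open import Function.Bundles using (_↔_; _⇔_)
open import Function.Definitions using (Injective; Bijective)
open import Relation.Binary.Construct.Closure.ReflexiveTransitive using (Star)
open import Relation.Binary.Construct.Closure.Symmetric using (SymClosure)

Rel₂ : Set → Set₁
Rel₂ X = X → X → Set

IsHom : {X Y : Set} → Rel₂ X → Rel₂ Y → (X → Y) → Set
IsHom ρ σ g = ∀ {x y} → ρ x y → σ (g x) (g y)

IsMono : {X Y : Set} → Rel₂ X → Rel₂ Y → (X → Y) → Set
IsMono ρ σ g = Injective _≡_ _≡_ g × IsHom ρ σ g

IsCondensation : {X Y : Set} → Rel₂ X → Rel₂ Y → (X → Y) → Set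
IsCondensation ρ σ g = Bijective _≡_ _≡_ g × IsHom ρ σ g

IsIso : {X Y : Set} → Rel₂ X → Rel₂ Y → (X → Y) → Set
IsIso {X} {Y} ρ σ g =
  IsHom ρ σ g ×
  Σ (Y → X) (λ h → (∀ x → h (g x) ≡ x) × (∀ y → g (h y) ≡ y) × IsHom σ ρ h)

Isomorphic : {X Y : Set} → Rel₂ X → Rel₂ Y → Set
Isomorphic {X} {Y} ρ σ = Σ (X → Y) (IsIso ρ σ)

Reversible : {X : Set} → Rel₂ X → Set
Reversible {X} ρ = (g : X → X) → IsCondensation ρ ρ g → IsIso ρ ρ g

Connected : {X : Set} → Rel₂ X → Set
Connected {X} ρ = (x y : X) → Star (SymClosure ρ) x y

-- a subset A ⊆ X is a proposition-valued predicate
IsSubset : {X : Set} → (X → Set) → Set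
IsSubset {X} A = (x : X) (p q : A x) → p ≡ q

RichForMonos : {I : Set} (X : I → Set) (ρ : (i : I) → Rel₂ (X i)) → Set₁
RichForMonos {I} X ρ =
  (i j : I) (A : X j → Set) → IsSubset A →
  (Σ (X j) A ↔ X i) →
  Σ (X i → X j) λ g → IsMono (ρ i) (ρ j) g × ((y : X j) → A y ⇔ (∃ λ x → g x ≡ y))

data UnionRel {I : Set} (X : I → Set) (ρ : (i : I) → Rel₂ (X i)) :
       Σ I X → Σ I X → Set where
  inj : ∀ {i x y} → ρ i x y → UnionRel X ρ (i , x) (i , y)

Surj : {I : Set} → (I → I) → Set
Surj {I} f = (j : I) → ∃ λ i → f i ≡ j

-- reversible sequence of cardinals ⟨|X i| : i ∈ I⟩: no non-injective surjection
-- f : I → I with |X j| = Σ_{i ∈ f⁻¹[j]} |X i| for all j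
-- (the cardinal sum being the cardinality of the disjoint union of the X i over the fibre)
ReversibleCardSeq : {I : Set} → (I → Set) → Set
ReversibleCardSeq {I} X =
  ¬ (Σ (I → I) λ f → Surj f × ¬ Injective _≡_ _≡_ f ×
       ((j : I) → X j ↔ Σ (Σ I (λ i → f i ≡ j)) (λ p → X (proj₁ p))))

-- Rich for monomorphisms means every bijection between carriers is realised by a
-- condensation, so X i and X j of equal size admit condensations both ways; for
-- reversible X i this forces the condensation X i → X j to be an isomorphism, which is (a).
-- For (b), connectedness makes every condensation F of the union move whole components:
-- it lies over a surjection f : I → I whose fibres decompose each |X j| as
-- Σ_{f i = j} |X i|. Conversely richness turns any such decomposition into a condensation
-- of the union lying over f. So the union is reversible exactly when every such f is
-- injective; and once f is injective, F is an isomorphism because, as in (a), each of its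
-- restrictions X i → X (f i) is one.
module Submission where

open import Defs
open import Axiom.ExcludedMiddle using (ExcludedMiddle)
open import Axiom.UniquenessOfIdentityProofs.WithK using (uip)
open import Data.Empty using (⊥-elim)
open import Data.Product using (Σ; ∃; _×_; _,_; proj₁; proj₂)
open import Data.Product.Properties using (Σ-≡,≡→≡; ,-injectiveʳ-≡; ,-injectiveʳ-UIP)
open import Data.Unit using (⊤; tt)
open import Function.Base using (_∘_)
open import Function.Bundles using (_↔_; _⇔_; Inverse; Equivalence; mk↔ₛ′; mk⇔; mk⤖)
open import Function.Consequences.Propositional
  using (strictlySurjective⇒surjective; surjective⇒strictlySurjective)
import Function.Construct.Composition as Composition
open import Function.Definitions using (Injective; Bijective; StrictlySurjective)
open import Function.Properties.Bijection using (⤖⇒↔)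
open import Function.Properties.Inverse using (↔-sym)
open import Level using (0ℓ)
open import Relation.Binary.Construct.Closure.ReflexiveTransitive as Star using (Star; ε; _◅_)
open import Relation.Binary.Construct.Closure.Symmetric as Sym using (SymClosure; fwd; bwd)
open import Relation.Binary.PropositionalEquality
open import Relation.Nullary using (yes; no)

InverseOf : {X Y : Set} → (X → Y) → (Y → X) → Set
InverseOf g h = (∀ x → h (g x) ≡ x) × (∀ y → g (h y) ≡ y)

bijective⇒inverse : {X Y : Set} {g : X → Y} → Bijective _≡_ _≡_ g → Σ (Y → X) (InverseOf g)
bijective⇒inverse {X} {Y} {g} (g-inj , g-surj) = h , (λ x → g-inj (g∘h (g x))) , g∘h
  where
  h : Y → X
  h y = proj₁ (g-surj y)
  g∘h : ∀ y → g (h y) ≡ y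
  g∘h y = proj₂ (g-surj y) refl

Reflects : {X Y : Set} → Rel₂ X → Rel₂ Y → (X → Y) → Set
Reflects ρ σ g = ∀ {x y} → σ (g x) (g y) → ρ x y

iso⇒reflects : {X Y : Set} {ρ : Rel₂ X} {σ : Rel₂ Y} {g : X → Y} → IsIso ρ σ g → Reflects ρ σ g
iso⇒reflects {ρ = ρ} (_ , _ , g⁻¹∘g , _ , g⁻¹-hom) r = subst₂ ρ (g⁻¹∘g _) (g⁻¹∘g _) (g⁻¹-hom r)

module _ {X Y : Set} {ρ : Rel₂ X} {σ : Rel₂ Y} {g : X → Y} where

  reflecting-condensation⇒iso : IsCondensation ρ σ g → Reflects ρ σ g → IsIso ρ σ g
  reflecting-condensation⇒iso (g-bij , g-hom) g-refl =
    let g⁻¹ , g⁻¹∘g , g∘g⁻¹ = bijective⇒inverse g-bij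
    in g-hom , g⁻¹ , g⁻¹∘g , g∘g⁻¹ , λ r → g-refl (subst₂ σ (sym (g∘g⁻¹ _)) (sym (g∘g⁻¹ _)) r)

  -- h ∘ g is a condensation of the reversible ρ, hence an automorphism, so it reflects ρ.
  condensations-both-ways⇒iso : {h : Y → X} → Reversible ρ →
    IsCondensation ρ σ g → IsCondensation σ ρ h → IsIso ρ σ g
  condensations-both-ways⇒iso {h} rev g-cond@(g-bij , g-hom) (h-bij , h-hom) =
    reflecting-condensation⇒iso g-cond (λ r → iso⇒reflects h∘g-iso (h-hom r))
    where
    h∘g-iso : IsIso ρ ρ (h ∘ g)
    h∘g-iso = rev (h ∘ g) (Composition.bijective _≡_ _≡_ _≡_ g-bij h-bij , h-hom ∘ g-hom)

Path : {X : Set} → Rel₂ X → Rel₂ X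
Path ρ = Star (SymClosure ρ)

hom-preserves-Path : {X Y : Set} {ρ : Rel₂ X} {σ : Rel₂ Y} {g : X → Y} →
  IsHom ρ σ g → ∀ {x y} → Path ρ x y → Path σ (g x) (g y)
hom-preserves-Path {g = g} g-hom = Star.gmap g (Sym.gmap g g-hom)

module _ {I : Set} {X : I → Set} {ρ : (i : I) → Rel₂ (X i)} (rich : RichForMonos X ρ) where

  condensation-from-↔ : {i j : I} → X i ↔ X j → Σ (X i → X j) (IsCondensation (ρ i) (ρ j))
  condensation-from-↔ {i} {j} X-i↔X-j =
    let g , (g-inj , g-hom) , g-image = rich i j (λ _ → ⊤) (λ _ _ _ → refl) everything↔X-i
    in g , (g-inj , strictlySurjective⇒surjective (λ y → Equivalence.to (g-image y) tt)) , g-hom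
    where
    open Inverse X-i↔X-j
    everything↔X-i : Σ (X j) (λ _ → ⊤) ↔ X i
    everything↔X-i = mk↔ₛ′ (from ∘ proj₁) (λ x → to x , tt)
      strictlyInverseʳ (λ p → cong (_, tt) (strictlyInverseˡ (proj₁ p)))

  condensation⇒iso : {i j : I} {g : X i → X j} → Reversible (ρ i) →
    IsCondensation (ρ i) (ρ j) g → IsIso (ρ i) (ρ j) g
  condensation⇒iso rev g-cond@(g-bij , _) = condensations-both-ways⇒iso rev g-cond
    (proj₂ (condensation-from-↔ (↔-sym (⤖⇒↔ (mk⤖ g-bij)))))

  isomorphic-from-↔ : {i j : I} → Reversible (ρ i) → X i ↔ X j → Isomorphic (ρ i) (ρ j)
  isomorphic-from-↔ rev X-i↔X-j =
    let g , g-cond = condensation-from-↔ X-i↔X-j in g , condensation⇒iso rev g-cond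

Fibre : {I : Set} → (I → Set) → (I → I) → I → Set
Fibre X f j = Σ (Σ _ (λ i → f i ≡ j)) (X ∘ proj₁)

module _ {I : Set} {X : I → Set} {ρ : (i : I) → Rel₂ (X i)} where

  U : Rel₂ (Σ I X)
  U = UnionRel X ρ

  UnionRel-index : ∀ {a b} → U a b → proj₁ a ≡ proj₁ b
  UnionRel-index (inj _) = refl

  UnionRel-component : ∀ {i x y} → U (i , x) (i , y) → ρ i x y
  UnionRel-component (inj r) = r

  Path-index : ∀ {a b} → Path U a b → proj₁ a ≡ proj₁ b
  Path-index ε           = refl
  Path-index (fwd r ◅ p) = trans (UnionRel-index r) (Path-index p)
  Path-index (bwd r ◅ p) = trans (sym (UnionRel-index r)) (Path-index p)

  module _ (conn : (i : I) → Connected (ρ i)) where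

    connected-Path : ∀ {a b} → proj₁ a ≡ proj₁ b → Path U a b
    connected-Path {i , x} {.i , y} refl = hom-preserves-Path inj (conn i x y)

    hom-preserves-index : {F : Σ I X → Σ I X} → IsHom U U F →
      ∀ {a b} → proj₁ a ≡ proj₁ b → proj₁ (F a) ≡ proj₁ (F b)
    hom-preserves-index F-hom e = Path-index (hom-preserves-Path F-hom (connected-Path e))

    iso-reflects-index : {F : Σ I X → Σ I X} → IsIso U U F →
      ∀ {a b} → proj₁ (F a) ≡ proj₁ (F b) → proj₁ a ≡ proj₁ b
    iso-reflects-index (_ , _ , F⁻¹∘F , _ , F⁻¹-hom) {a} {b} e =
      subst₂ (λ a b → proj₁ a ≡ proj₁ b) (F⁻¹∘F a) (F⁻¹∘F b) (hom-preserves-index F⁻¹-hom e)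

  fibre-label : {f : I → I} {j : I} → Fibre X f j → I
  fibre-label = proj₁ ∘ proj₁

  fibre-point : {f : I → I} {j : I} → Fibre X f j → Σ I X
  fibre-point ((i , _) , x) = i , x

  fibre-point-injective : {f : I → I} {j : I} → Injective _≡_ _≡_ (fibre-point {f} {j})
  fibre-point-injective {x = (i , p) , x} {(.i , p′) , .x} refl = cong (λ q → (i , q) , x) (uip p p′)

  labelled-part : {f : I → I} {i : I} {Y : Set} (φ : Y ↔ Fibre X f (f i)) →
    Σ Y (λ y → fibre-label (Inverse.to φ y) ≡ i) ↔ X i
  labelled-part {f} {i} {Y} φ = mk↔ₛ′ select embed select∘embed embed∘select
    where
    open Inverse φ
    select : Σ Y (λ y → fibre-label (to y) ≡ i) → X i
    select (y , e) = subst X e (proj₂ (to y))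
    embed : X i → Σ Y (λ y → fibre-label (to y) ≡ i)
    embed x = from ((i , refl) , x) , cong fibre-label (strictlyInverseˡ _)
    select∘embed : ∀ x → select (embed x) ≡ x
    select∘embed x = ,-injectiveʳ-≡ uip (cong fibre-point (strictlyInverseˡ ((i , refl) , x))) _
    embed∘select : ∀ p → embed (select p) ≡ p
    embed∘select (y , e) = Σ-≡,≡→≡ (trans (cong from relabel) (strictlyInverseʳ y) , uip _ _)
      where
      relabel : ((i , refl) , select (y , e)) ≡ to y
      relabel = fibre-point-injective (sym (Σ-≡,≡→≡ (e , refl)))

  _LiesOver_ : (Σ I X → Σ I X) → (I → I) → Set
  F LiesOver f = ∀ a → proj₁ (F a) ≡ f (proj₁ a)

  module _ (F : Σ I X → Σ I X) {f : I → I} (over : F LiesOver f) where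

    restrict : (i : I) → X i → X (f i)
    restrict i x = subst X (over (i , x)) (proj₂ (F (i , x)))

    restrict-spec : ∀ i x → F (i , x) ≡ (f i , restrict i x)
    restrict-spec i x = Σ-≡,≡→≡ (over (i , x) , refl)

    restrict-isHom : IsHom U U F → ∀ i → IsHom (ρ i) (ρ (f i)) (restrict i)
    restrict-isHom F-hom i {x} {y} r =
      UnionRel-component (subst₂ U (restrict-spec i x) (restrict-spec i y) (F-hom (inj r)))

    restrict-injective : Injective _≡_ _≡_ F → ∀ i → Injective _≡_ _≡_ (restrict i)
    restrict-injective F-inj i {x} {y} e = ,-injectiveʳ-UIP uip
      (F-inj (trans (restrict-spec i x) (trans (cong (f i ,_) e) (sym (restrict-spec i y)))))

    restrict-surjective : StrictlySurjective _≡_ F → Injective _≡_ _≡_ f →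
      ∀ i → StrictlySurjective _≡_ (restrict i)
    restrict-surjective F-surj f-inj i y with F-surj (f i , y)
    ... | (i′ , x) , Fa≡ with f-inj (trans (sym (over (i′ , x))) (cong proj₁ Fa≡))
    ... | refl = x , ,-injectiveʳ-UIP uip (trans (sym (restrict-spec i x)) Fa≡)

    reflects-by-restrictions : Injective _≡_ _≡_ f →
      (∀ i → Reflects (ρ i) (ρ (f i)) (restrict i)) → Reflects U U F
    reflects-by-restrictions f-inj restrict-reflects {i , x} {i′ , x′} r
      with f-inj (trans (sym (over (i , x))) (trans (UnionRel-index r) (over (i′ , x′))))
    ... | refl = inj (restrict-reflects i
                   (UnionRel-component (subst₂ U (restrict-spec i x) (restrict-spec i x′) r)))

    restrict-condensation : IsCondensation U U F → Injective _≡_ _≡_ f →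
      ∀ i → IsCondensation (ρ i) (ρ (f i)) (restrict i)
    restrict-condensation ((F-inj , F-surj) , F-hom) f-inj i =
      ( restrict-injective F-inj i
      , strictlySurjective⇒surjective
          (restrict-surjective (surjective⇒strictlySurjective F-surj) f-inj i))
      , restrict-isHom F-hom i

    fibres-of-bijection : {F⁻¹ : Σ I X → Σ I X} → InverseOf F F⁻¹ → ∀ j → X j ↔ Fibre X f j
    fibres-of-bijection {F⁻¹} (F⁻¹∘F , F∘F⁻¹) j = mk↔ₛ′ to from to∘from from∘to
      where
      preimage-index : ∀ y → f (proj₁ (F⁻¹ (j , y))) ≡ j
      preimage-index y = trans (sym (over (F⁻¹ (j , y)))) (cong proj₁ (F∘F⁻¹ (j , y)))
      to : X j → Fibre X f j
      to y = (proj₁ (F⁻¹ (j , y)) , preimage-index y) , proj₂ (F⁻¹ (j , y))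
      from : Fibre X f j → X j
      from ((i , p) , x) = subst X p (restrict i x)
      from∘to : ∀ y → from (to y) ≡ y
      from∘to y = ,-injectiveʳ-≡ uip
        (trans (sym (restrict-spec _ _)) (F∘F⁻¹ (j , y))) (preimage-index y)
      to∘from : ∀ w → to (from w) ≡ w
      to∘from w@((i , p) , x) = fibre-point-injective (begin
        F⁻¹ (j , from w)       ≡⟨ cong F⁻¹ (Σ-≡,≡→≡ (sym p , subst-sym-subst p)) ⟩
        F⁻¹ (f i , restrict i x) ≡⟨ cong F⁻¹ (restrict-spec i x) ⟨
        F⁻¹ (F (i , x))        ≡⟨ F⁻¹∘F (i , x) ⟩
        (i , x)                ∎)
        where open ≡-Reasoning

  module _ (rich : RichForMonos X ρ) {f : I → I} (φ : ∀ j → X j ↔ Fibre X f j) where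

    label : Σ I X → I
    label (j , y) = fibre-label (Inverse.to (φ j) y)

    labelled-embedding : ∀ i → Σ (X i → X (f i)) λ g → IsMono (ρ i) (ρ (f i)) g ×
      ((y : X (f i)) → (label (f i , y) ≡ i) ⇔ ∃ λ x → g x ≡ y)
    labelled-embedding i =
      rich i (f i) (λ y → label (f i , y) ≡ i) (λ _ → uip) (labelled-part (φ (f i)))

    condensation-over : Σ (Σ I X → Σ I X) λ F → IsCondensation U U F × F LiesOver f
    condensation-over = F , ((F-inj , strictlySurjective⇒surjective F-surj) , F-hom) , λ _ → refl
      where
      g : ∀ i → X i → X (f i)
      g i = proj₁ (labelled-embedding i)
      g-inj : ∀ i → Injective _≡_ _≡_ (g i)
      g-inj i = proj₁ (proj₁ (proj₂ (labelled-embedding i)))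
      g-hom : ∀ i → IsHom (ρ i) (ρ (f i)) (g i)
      g-hom i = proj₂ (proj₁ (proj₂ (labelled-embedding i)))
      g-labelled : ∀ i y → (label (f i , y) ≡ i) ⇔ ∃ λ x → g i x ≡ y
      g-labelled i = proj₂ (proj₂ (labelled-embedding i))
      F : Σ I X → Σ I X
      F (i , x) = f i , g i x
      label-F : ∀ i x → label (F (i , x)) ≡ i
      label-F i x = Equivalence.from (g-labelled i (g i x)) (x , refl)
      F-inj : Injective _≡_ _≡_ F
      F-inj {i , x} {i′ , x′} e with trans (sym (label-F i x)) (trans (cong label e) (label-F i′ x′))
      ... | refl = cong (i ,_) (g-inj i (,-injectiveʳ-UIP uip e))
      F-surj : StrictlySurjective _≡_ F
      F-surj (j , y) with Inverse.to (φ j) y in e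
      ... | (i , refl) , _ = let x , gx≡y = Equivalence.to (g-labelled i y) (cong fibre-label e)
                             in (i , x) , cong (f i ,_) gx≡y
      F-hom : IsHom U U F
      F-hom (inj {i} r) = inj (g-hom i r)

  module _ (conn : (i : I) → Connected (ρ i)) (pt : (i : I) → X i) (rich : RichForMonos X ρ) where

    reversible⇒reversible-cardinals : Reversible U → ReversibleCardSeq X
    reversible⇒reversible-cardinals rev-U (f , _ , f-not-inj , φ) =
      let F , F-cond , over = condensation-over rich φ
      in f-not-inj λ {i₁} {i₂} e → iso-reflects-index conn (rev-U F F-cond) {i₁ , pt i₁} {i₂ , pt i₂}
           (trans (over (i₁ , pt i₁)) (trans e (sym (over (i₂ , pt i₂)))))

    reversible-cardinals⇒reversible : ExcludedMiddle 0ℓ → ((i : I) → Reversible (ρ i)) →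
      ReversibleCardSeq X → Reversible U
    reversible-cardinals⇒reversible lem rev rcs F F-cond@(F-bij , F-hom) =
      reflecting-condensation⇒iso F-cond (reflects-by-restrictions F over f-inj restrict-reflects)
      where
      f : I → I
      f i = proj₁ (F (i , pt i))
      over : F LiesOver f
      over (i , x) = hom-preserves-index conn F-hom {i , x} {i , pt i} refl
      φ : ∀ j → X j ↔ Fibre X f j
      φ = fibres-of-bijection F over (proj₂ (bijective⇒inverse F-bij))
      f-surj : Surj f
      f-surj j = proj₁ (Inverse.to (φ j) (pt j))
      -- ReversibleCardSeq only refutes non-injectivity of f;
      -- excluded middle on i₁ ≡ i₂ turns that into injectivity.
      f-inj : Injective _≡_ _≡_ f
      f-inj {i₁} {i₂} e with lem {i₁ ≡ i₂}
      ... | yes i₁≡i₂ = i₁≡i₂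
      ... | no i₁≢i₂ = ⊥-elim (rcs (f , f-surj , (λ f-inj → i₁≢i₂ (f-inj e)) , φ))
      restrict-reflects : ∀ i → Reflects (ρ i) (ρ (f i)) (restrict F over i)
      restrict-reflects i =
        iso⇒reflects (condensation⇒iso rich (rev i) (restrict-condensation F over F-cond f-inj i))

theorem3p1 : ExcludedMiddle 0ℓ →
    (I : Set) → I → (X : I → Set) → (ρ : (i : I) → Rel₂ (X i)) →
    ((i : I) → X i) →
    ((i : I) → Connected (ρ i)) →
    ((i : I) → Reversible (ρ i)) →
    RichForMonos X ρ →
    ((i j : I) → (X i ↔ X j) → Isomorphic (ρ i) (ρ j)) ×
    (Reversible (UnionRel X ρ) ⇔ ReversibleCardSeq X)
theorem3p1 lem I _ X ρ pt conn rev rich =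
    (λ i j → isomorphic-from-↔ rich (rev i))
  , mk⇔ (reversible⇒reversible-cardinals conn pt rich)
        (reversible-cardinals⇒reversible conn pt rich lem rev)
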